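{- Let $p$ and $q$ be terms in the language $\langle \vee,\wedge,{}^{*},0,1\rangle$ of QB-algebras. Then the identity $p\approx q$ holds in every QB-algebra if and only if $p\approx q$ holds in the algebra $\mathbf{4}$.
   Context: A quasi-lattice is an algebra $\langle L;\vee,\wedge\rangle$ such that for all $x,y,z$: $\vee,\wedge$ are commutative and associative; $x\vee(x\wedge y)=x\vee x$ and $x\wedge(x\vee y)=x\wedge x$; $x\vee(y\vee y)=x\vee y$ and $x\wedge(y\wedge y)=x\wedge y$; $x\vee x=x\wedge x$. It is distributive if $x\vee(y\wedge z)=(x\vee y)\wedge(x\vee z)$ and $x\wedge(y\vee z)=(x\wedge y)\vee(x\wedge z)$. A quasi-Boolean algebra (QB-algebra) is an algebra $\langle Q;\vee,\wedge,{}^{*},0,1\rangle$ of type $\langle 2,2,1,0,0\rangle$ such that $\langle Q;\vee,\wedge\rangle$ is a distributive quasi-lattice and for all $x$: $x\vee 1=1$, $x\wedge 0=0$, $x\vee x^{*}=1$, $x\wedge x^{*}=0$, $(x\wedge x)^{*}=x^{*}\vee x^{*}$, $x^{**}=x$. The QB-algebra $\mathbf{4}$ has universe $\{0,a,b,1\}$ with: $x\vee y=0$ if $x,y\in\{0,a\}$ and $x\vee y=1$ otherwise; $x\wedge y=1$ if $x,y\in\{b,1\}$ and $x\wedge y=0$ otherwise; $0^{*}=1$, $a^{*}=b$, $b^{*}=a$, $1^{*}=0$. -}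

module Defs where

open import Data.Nat using (ℕ)
open import Relation.Binary.PropositionalEquality using (_≡_)

record IsQuasiLattice {A : Set} (_∨_ _∧_ : A → A → A) : Set where
  field
    ∨-comm   : ∀ x y → (x ∨ y) ≡ (y ∨ x)
    ∧-comm   : ∀ x y → (x ∧ y) ≡ (y ∧ x)
    ∨-assoc  : ∀ x y z → ((x ∨ y) ∨ z) ≡ (x ∨ (y ∨ z))
    ∧-assoc  : ∀ x y z → ((x ∧ y) ∧ z) ≡ (x ∧ (y ∧ z))
    ∨-absorb : ∀ x y → (x ∨ (x ∧ y)) ≡ (x ∨ x)
    ∧-absorb : ∀ x y → (x ∧ (x ∨ y)) ≡ (x ∧ x)
    ∨-idem   : ∀ x y → (x ∨ (y ∨ y)) ≡ (x ∨ y)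
    ∧-idem   : ∀ x y → (x ∧ (y ∧ y)) ≡ (x ∧ y)
    ∨∧-same  : ∀ x → (x ∨ x) ≡ (x ∧ x)

record IsDistributiveQuasiLattice {A : Set} (_∨_ _∧_ : A → A → A) : Set where
  field
    isQuasiLattice : IsQuasiLattice _∨_ _∧_
    ∨-distrib-∧ : ∀ x y z → (x ∨ (y ∧ z)) ≡ ((x ∨ y) ∧ (x ∨ z))
    ∧-distrib-∨ : ∀ x y z → (x ∧ (y ∨ z)) ≡ ((x ∧ y) ∨ (x ∧ z))

record QBAlgebra : Set₁ where
  field
    Carrier : Set
    _∨_ : Carrier → Carrier → Carrier
    _∧_ : Carrier → Carrier → Carrier
    _*  : Carrier → Carrier
    𝟎   : Carrier
    𝟏   : Carrier
    isDQL   : IsDistributiveQuasiLattice _∨_ _∧_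
    ∨-one   : ∀ x → (x ∨ 𝟏) ≡ 𝟏
    ∧-zero  : ∀ x → (x ∧ 𝟎) ≡ 𝟎
    ∨-compl : ∀ x → (x ∨ (x *)) ≡ 𝟏
    ∧-compl : ∀ x → (x ∧ (x *)) ≡ 𝟎
    *-∧∧    : ∀ x → ((x ∧ x) *) ≡ ((x *) ∨ (x *))
    *-invol : ∀ x → ((x *) *) ≡ x

data Term : Set where
  var  : ℕ → Term
  _∨ₜ_ : Term → Term → Term
  _∧ₜ_ : Term → Term → Term
  _*ₜ  : Term → Term
  0ₜ   : Term
  1ₜ   : Term

⟦_⟧ : Term → (Q : QBAlgebra) → (ℕ → QBAlgebra.Carrier Q) → QBAlgebra.Carrier Q
⟦ var i ⟧  Q ρ = ρ i
⟦ p ∨ₜ q ⟧ Q ρ = QBAlgebra._∨_ Q (⟦ p ⟧ Q ρ) (⟦ q ⟧ Q ρ)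
⟦ p ∧ₜ q ⟧ Q ρ = QBAlgebra._∧_ Q (⟦ p ⟧ Q ρ) (⟦ q ⟧ Q ρ)
⟦ p *ₜ ⟧   Q ρ = QBAlgebra._* Q (⟦ p ⟧ Q ρ)
⟦ 0ₜ ⟧     Q ρ = QBAlgebra.𝟎 Q
⟦ 1ₜ ⟧     Q ρ = QBAlgebra.𝟏 Q

_⊨_≈_ : QBAlgebra → Term → Term → Set
Q ⊨ p ≈ q = ∀ (ρ : ℕ → QBAlgebra.Carrier Q) → ⟦ p ⟧ Q ρ ≡ ⟦ q ⟧ Q ρ

data Four : Set where
  f0 fa fb f1 : Four

_∨₄_ : Four → Four → Four
f0 ∨₄ f0 = f0
f0 ∨₄ fa = f0
fa ∨₄ f0 = f0
fa ∨₄ fa = f0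
_  ∨₄ _  = f1

_∧₄_ : Four → Four → Four
fb ∧₄ fb = f1
fb ∧₄ f1 = f1
f1 ∧₄ fb = f1
f1 ∧₄ f1 = f1
_  ∧₄ _  = f0

_*₄ : Four → Four
f0 *₄ = f1
fa *₄ = fb
fb *₄ = fa
f1 *₄ = f0

open import Relation.Binary.PropositionalEquality using (refl)

private
  l-∨comm : ∀ x y → (x ∨₄ y) ≡ (y ∨₄ x)
  l-∨comm f0 f0 = refl
  l-∨comm f0 fa = refl
  l-∨comm f0 fb = refl
  l-∨comm f0 f1 = refl
  l-∨comm fa f0 = refl
  l-∨comm fa fa = refl
  l-∨comm fa fb = refl
  l-∨comm fa f1 = refl
  l-∨comm fb f0 = refl
  l-∨comm fb fa = refl
  l-∨comm fb fb = refl
  l-∨comm fb f1 = refl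
  l-∨comm f1 f0 = refl
  l-∨comm f1 fa = refl
  l-∨comm f1 fb = refl
  l-∨comm f1 f1 = refl
  l-∧comm : ∀ x y → (x ∧₄ y) ≡ (y ∧₄ x)
  l-∧comm f0 f0 = refl
  l-∧comm f0 fa = refl
  l-∧comm f0 fb = refl
  l-∧comm f0 f1 = refl
  l-∧comm fa f0 = refl
  l-∧comm fa fa = refl
  l-∧comm fa fb = refl
  l-∧comm fa f1 = refl
  l-∧comm fb f0 = refl
  l-∧comm fb fa = refl
  l-∧comm fb fb = refl
  l-∧comm fb f1 = refl
  l-∧comm f1 f0 = refl
  l-∧comm f1 fa = refl
  l-∧comm f1 fb = refl
  l-∧comm f1 f1 = refl
  l-∨assoc : ∀ x y z → ((x ∨₄ y) ∨₄ z) ≡ (x ∨₄ (y ∨₄ z))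
  l-∨assoc f0 f0 f0 = refl
  l-∨assoc f0 f0 fa = refl
  l-∨assoc f0 f0 fb = refl
  l-∨assoc f0 f0 f1 = refl
  l-∨assoc f0 fa f0 = refl
  l-∨assoc f0 fa fa = refl
  l-∨assoc f0 fa fb = refl
  l-∨assoc f0 fa f1 = refl
  l-∨assoc f0 fb f0 = refl
  l-∨assoc f0 fb fa = refl
  l-∨assoc f0 fb fb = refl
  l-∨assoc f0 fb f1 = refl
  l-∨assoc f0 f1 f0 = refl
  l-∨assoc f0 f1 fa = refl
  l-∨assoc f0 f1 fb = refl
  l-∨assoc f0 f1 f1 = refl
  l-∨assoc fa f0 f0 = refl
  l-∨assoc fa f0 fa = refl
  l-∨assoc fa f0 fb = refl
  l-∨assoc fa f0 f1 = refl
  l-∨assoc fa fa f0 = refl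
  l-∨assoc fa fa fa = refl
  l-∨assoc fa fa fb = refl
  l-∨assoc fa fa f1 = refl
  l-∨assoc fa fb f0 = refl
  l-∨assoc fa fb fa = refl
  l-∨assoc fa fb fb = refl
  l-∨assoc fa fb f1 = refl
  l-∨assoc fa f1 f0 = refl
  l-∨assoc fa f1 fa = refl
  l-∨assoc fa f1 fb = refl
  l-∨assoc fa f1 f1 = refl
  l-∨assoc fb f0 f0 = refl
  l-∨assoc fb f0 fa = refl
  l-∨assoc fb f0 fb = refl
  l-∨assoc fb f0 f1 = refl
  l-∨assoc fb fa f0 = refl
  l-∨assoc fb fa fa = refl
  l-∨assoc fb fa fb = refl
  l-∨assoc fb fa f1 = refl
  l-∨assoc fb fb f0 = refl
  l-∨assoc fb fb fa = refl
  l-∨assoc fb fb fb = refl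
  l-∨assoc fb fb f1 = refl
  l-∨assoc fb f1 f0 = refl
  l-∨assoc fb f1 fa = refl
  l-∨assoc fb f1 fb = refl
  l-∨assoc fb f1 f1 = refl
  l-∨assoc f1 f0 f0 = refl
  l-∨assoc f1 f0 fa = refl
  l-∨assoc f1 f0 fb = refl
  l-∨assoc f1 f0 f1 = refl
  l-∨assoc f1 fa f0 = refl
  l-∨assoc f1 fa fa = refl
  l-∨assoc f1 fa fb = refl
  l-∨assoc f1 fa f1 = refl
  l-∨assoc f1 fb f0 = refl
  l-∨assoc f1 fb fa = refl
  l-∨assoc f1 fb fb = refl
  l-∨assoc f1 fb f1 = refl
  l-∨assoc f1 f1 f0 = refl
  l-∨assoc f1 f1 fa = refl
  l-∨assoc f1 f1 fb = refl
  l-∨assoc f1 f1 f1 = refl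
  l-∧assoc : ∀ x y z → ((x ∧₄ y) ∧₄ z) ≡ (x ∧₄ (y ∧₄ z))
  l-∧assoc f0 f0 f0 = refl
  l-∧assoc f0 f0 fa = refl
  l-∧assoc f0 f0 fb = refl
  l-∧assoc f0 f0 f1 = refl
  l-∧assoc f0 fa f0 = refl
  l-∧assoc f0 fa fa = refl
  l-∧assoc f0 fa fb = refl
  l-∧assoc f0 fa f1 = refl
  l-∧assoc f0 fb f0 = refl
  l-∧assoc f0 fb fa = refl
  l-∧assoc f0 fb fb = refl
  l-∧assoc f0 fb f1 = refl
  l-∧assoc f0 f1 f0 = refl
  l-∧assoc f0 f1 fa = refl
  l-∧assoc f0 f1 fb = refl
  l-∧assoc f0 f1 f1 = refl
  l-∧assoc fa f0 f0 = refl
  l-∧assoc fa f0 fa = refl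
  l-∧assoc fa f0 fb = refl
  l-∧assoc fa f0 f1 = refl
  l-∧assoc fa fa f0 = refl
  l-∧assoc fa fa fa = refl
  l-∧assoc fa fa fb = refl
  l-∧assoc fa fa f1 = refl
  l-∧assoc fa fb f0 = refl
  l-∧assoc fa fb fa = refl
  l-∧assoc fa fb fb = refl
  l-∧assoc fa fb f1 = refl
  l-∧assoc fa f1 f0 = refl
  l-∧assoc fa f1 fa = refl
  l-∧assoc fa f1 fb = refl
  l-∧assoc fa f1 f1 = refl
  l-∧assoc fb f0 f0 = refl
  l-∧assoc fb f0 fa = refl
  l-∧assoc fb f0 fb = refl
  l-∧assoc fb f0 f1 = refl
  l-∧assoc fb fa f0 = refl
  l-∧assoc fb fa fa = refl
  l-∧assoc fb fa fb = refl
  l-∧assoc fb fa f1 = refl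
  l-∧assoc fb fb f0 = refl
  l-∧assoc fb fb fa = refl
  l-∧assoc fb fb fb = refl
  l-∧assoc fb fb f1 = refl
  l-∧assoc fb f1 f0 = refl
  l-∧assoc fb f1 fa = refl
  l-∧assoc fb f1 fb = refl
  l-∧assoc fb f1 f1 = refl
  l-∧assoc f1 f0 f0 = refl
  l-∧assoc f1 f0 fa = refl
  l-∧assoc f1 f0 fb = refl
  l-∧assoc f1 f0 f1 = refl
  l-∧assoc f1 fa f0 = refl
  l-∧assoc f1 fa fa = refl
  l-∧assoc f1 fa fb = refl
  l-∧assoc f1 fa f1 = refl
  l-∧assoc f1 fb f0 = refl
  l-∧assoc f1 fb fa = refl
  l-∧assoc f1 fb fb = refl
  l-∧assoc f1 fb f1 = refl
  l-∧assoc f1 f1 f0 = refl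
  l-∧assoc f1 f1 fa = refl
  l-∧assoc f1 f1 fb = refl
  l-∧assoc f1 f1 f1 = refl
  l-∨abs : ∀ x y → (x ∨₄ (x ∧₄ y)) ≡ (x ∨₄ x)
  l-∨abs f0 f0 = refl
  l-∨abs f0 fa = refl
  l-∨abs f0 fb = refl
  l-∨abs f0 f1 = refl
  l-∨abs fa f0 = refl
  l-∨abs fa fa = refl
  l-∨abs fa fb = refl
  l-∨abs fa f1 = refl
  l-∨abs fb f0 = refl
  l-∨abs fb fa = refl
  l-∨abs fb fb = refl
  l-∨abs fb f1 = refl
  l-∨abs f1 f0 = refl
  l-∨abs f1 fa = refl
  l-∨abs f1 fb = refl
  l-∨abs f1 f1 = refl
  l-∧abs : ∀ x y → (x ∧₄ (x ∨₄ y)) ≡ (x ∧₄ x)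
  l-∧abs f0 f0 = refl
  l-∧abs f0 fa = refl
  l-∧abs f0 fb = refl
  l-∧abs f0 f1 = refl
  l-∧abs fa f0 = refl
  l-∧abs fa fa = refl
  l-∧abs fa fb = refl
  l-∧abs fa f1 = refl
  l-∧abs fb f0 = refl
  l-∧abs fb fa = refl
  l-∧abs fb fb = refl
  l-∧abs fb f1 = refl
  l-∧abs f1 f0 = refl
  l-∧abs f1 fa = refl
  l-∧abs f1 fb = refl
  l-∧abs f1 f1 = refl
  l-∨idem : ∀ x y → (x ∨₄ (y ∨₄ y)) ≡ (x ∨₄ y)
  l-∨idem f0 f0 = refl
  l-∨idem f0 fa = refl
  l-∨idem f0 fb = refl
  l-∨idem f0 f1 = refl
  l-∨idem fa f0 = refl
  l-∨idem fa fa = refl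
  l-∨idem fa fb = refl
  l-∨idem fa f1 = refl
  l-∨idem fb f0 = refl
  l-∨idem fb fa = refl
  l-∨idem fb fb = refl
  l-∨idem fb f1 = refl
  l-∨idem f1 f0 = refl
  l-∨idem f1 fa = refl
  l-∨idem f1 fb = refl
  l-∨idem f1 f1 = refl
  l-∧idem : ∀ x y → (x ∧₄ (y ∧₄ y)) ≡ (x ∧₄ y)
  l-∧idem f0 f0 = refl
  l-∧idem f0 fa = refl
  l-∧idem f0 fb = refl
  l-∧idem f0 f1 = refl
  l-∧idem fa f0 = refl
  l-∧idem fa fa = refl
  l-∧idem fa fb = refl
  l-∧idem fa f1 = refl
  l-∧idem fb f0 = refl
  l-∧idem fb fa = refl
  l-∧idem fb fb = refl
  l-∧idem fb f1 = refl
  l-∧idem f1 f0 = refl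
  l-∧idem f1 fa = refl
  l-∧idem f1 fb = refl
  l-∧idem f1 f1 = refl
  l-same : ∀ x → (x ∨₄ x) ≡ (x ∧₄ x)
  l-same f0 = refl
  l-same fa = refl
  l-same fb = refl
  l-same f1 = refl
  l-d1 : ∀ x y z → (x ∨₄ (y ∧₄ z)) ≡ ((x ∨₄ y) ∧₄ (x ∨₄ z))
  l-d1 f0 f0 f0 = refl
  l-d1 f0 f0 fa = refl
  l-d1 f0 f0 fb = refl
  l-d1 f0 f0 f1 = refl
  l-d1 f0 fa f0 = refl
  l-d1 f0 fa fa = refl
  l-d1 f0 fa fb = refl
  l-d1 f0 fa f1 = refl
  l-d1 f0 fb f0 = refl
  l-d1 f0 fb fa = refl
  l-d1 f0 fb fb = refl
  l-d1 f0 fb f1 = refl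
  l-d1 f0 f1 f0 = refl
  l-d1 f0 f1 fa = refl
  l-d1 f0 f1 fb = refl
  l-d1 f0 f1 f1 = refl
  l-d1 fa f0 f0 = refl
  l-d1 fa f0 fa = refl
  l-d1 fa f0 fb = refl
  l-d1 fa f0 f1 = refl
  l-d1 fa fa f0 = refl
  l-d1 fa fa fa = refl
  l-d1 fa fa fb = refl
  l-d1 fa fa f1 = refl
  l-d1 fa fb f0 = refl
  l-d1 fa fb fa = refl
  l-d1 fa fb fb = refl
  l-d1 fa fb f1 = refl
  l-d1 fa f1 f0 = refl
  l-d1 fa f1 fa = refl
  l-d1 fa f1 fb = refl
  l-d1 fa f1 f1 = refl
  l-d1 fb f0 f0 = refl
  l-d1 fb f0 fa = refl
  l-d1 fb f0 fb = refl
  l-d1 fb f0 f1 = refl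
  l-d1 fb fa f0 = refl
  l-d1 fb fa fa = refl
  l-d1 fb fa fb = refl
  l-d1 fb fa f1 = refl
  l-d1 fb fb f0 = refl
  l-d1 fb fb fa = refl
  l-d1 fb fb fb = refl
  l-d1 fb fb f1 = refl
  l-d1 fb f1 f0 = refl
  l-d1 fb f1 fa = refl
  l-d1 fb f1 fb = refl
  l-d1 fb f1 f1 = refl
  l-d1 f1 f0 f0 = refl
  l-d1 f1 f0 fa = refl
  l-d1 f1 f0 fb = refl
  l-d1 f1 f0 f1 = refl
  l-d1 f1 fa f0 = refl
  l-d1 f1 fa fa = refl
  l-d1 f1 fa fb = refl
  l-d1 f1 fa f1 = refl
  l-d1 f1 fb f0 = refl
  l-d1 f1 fb fa = refl
  l-d1 f1 fb fb = refl
  l-d1 f1 fb f1 = refl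
  l-d1 f1 f1 f0 = refl
  l-d1 f1 f1 fa = refl
  l-d1 f1 f1 fb = refl
  l-d1 f1 f1 f1 = refl
  l-d2 : ∀ x y z → (x ∧₄ (y ∨₄ z)) ≡ ((x ∧₄ y) ∨₄ (x ∧₄ z))
  l-d2 f0 f0 f0 = refl
  l-d2 f0 f0 fa = refl
  l-d2 f0 f0 fb = refl
  l-d2 f0 f0 f1 = refl
  l-d2 f0 fa f0 = refl
  l-d2 f0 fa fa = refl
  l-d2 f0 fa fb = refl
  l-d2 f0 fa f1 = refl
  l-d2 f0 fb f0 = refl
  l-d2 f0 fb fa = refl
  l-d2 f0 fb fb = refl
  l-d2 f0 fb f1 = refl
  l-d2 f0 f1 f0 = refl
  l-d2 f0 f1 fa = refl
  l-d2 f0 f1 fb = refl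
  l-d2 f0 f1 f1 = refl
  l-d2 fa f0 f0 = refl
  l-d2 fa f0 fa = refl
  l-d2 fa f0 fb = refl
  l-d2 fa f0 f1 = refl
  l-d2 fa fa f0 = refl
  l-d2 fa fa fa = refl
  l-d2 fa fa fb = refl
  l-d2 fa fa f1 = refl
  l-d2 fa fb f0 = refl
  l-d2 fa fb fa = refl
  l-d2 fa fb fb = refl
  l-d2 fa fb f1 = refl
  l-d2 fa f1 f0 = refl
  l-d2 fa f1 fa = refl
  l-d2 fa f1 fb = refl
  l-d2 fa f1 f1 = refl
  l-d2 fb f0 f0 = refl
  l-d2 fb f0 fa = refl
  l-d2 fb f0 fb = refl
  l-d2 fb f0 f1 = refl
  l-d2 fb fa f0 = refl
  l-d2 fb fa fa = refl
  l-d2 fb fa fb = refl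
  l-d2 fb fa f1 = refl
  l-d2 fb fb f0 = refl
  l-d2 fb fb fa = refl
  l-d2 fb fb fb = refl
  l-d2 fb fb f1 = refl
  l-d2 fb f1 f0 = refl
  l-d2 fb f1 fa = refl
  l-d2 fb f1 fb = refl
  l-d2 fb f1 f1 = refl
  l-d2 f1 f0 f0 = refl
  l-d2 f1 f0 fa = refl
  l-d2 f1 f0 fb = refl
  l-d2 f1 f0 f1 = refl
  l-d2 f1 fa f0 = refl
  l-d2 f1 fa fa = refl
  l-d2 f1 fa fb = refl
  l-d2 f1 fa f1 = refl
  l-d2 f1 fb f0 = refl
  l-d2 f1 fb fa = refl
  l-d2 f1 fb fb = refl
  l-d2 f1 fb f1 = refl
  l-d2 f1 f1 f0 = refl
  l-d2 f1 f1 fa = refl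
  l-d2 f1 f1 fb = refl
  l-d2 f1 f1 f1 = refl
  l-one : ∀ x → (x ∨₄ f1) ≡ f1
  l-one f0 = refl
  l-one fa = refl
  l-one fb = refl
  l-one f1 = refl
  l-zero : ∀ x → (x ∧₄ f0) ≡ f0
  l-zero f0 = refl
  l-zero fa = refl
  l-zero fb = refl
  l-zero f1 = refl
  l-c1 : ∀ x → (x ∨₄ (x *₄)) ≡ f1
  l-c1 f0 = refl
  l-c1 fa = refl
  l-c1 fb = refl
  l-c1 f1 = refl
  l-c2 : ∀ x → (x ∧₄ (x *₄)) ≡ f0
  l-c2 f0 = refl
  l-c2 fa = refl
  l-c2 fb = refl
  l-c2 f1 = refl
  l-st : ∀ x → ((x ∧₄ x) *₄) ≡ ((x *₄) ∨₄ (x *₄))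
  l-st f0 = refl
  l-st fa = refl
  l-st fb = refl
  l-st f1 = refl
  l-inv : ∀ x → ((x *₄) *₄) ≡ x
  l-inv f0 = refl
  l-inv fa = refl
  l-inv fb = refl
  l-inv f1 = refl

𝟒 : QBAlgebra
𝟒 = record
  { Carrier = Four ; _∨_ = _∨₄_ ; _∧_ = _∧₄_ ; _* = _*₄ ; 𝟎 = f0 ; 𝟏 = f1
  ; isDQL = record
    { isQuasiLattice = record
      { ∨-comm = l-∨comm ; ∧-comm = l-∧comm ; ∨-assoc = l-∨assoc ; ∧-assoc = l-∧assoc
      ; ∨-absorb = l-∨abs ; ∧-absorb = l-∧abs ; ∨-idem = l-∨idem ; ∧-idem = l-∧idem
      ; ∨∧-same = l-same }
    ; ∨-distrib-∧ = l-d1 ; ∧-distrib-∨ = l-d2 }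
  ; ∨-one = l-one ; ∧-zero = l-zero ; ∨-compl = l-c1 ; ∧-compl = l-c2
  ; *-∧∧ = l-st ; *-invol = l-inv }

-- In a QB-algebra put reg x = x ∨ x (= x ∧ x). Modulo the relation reg x ≡ reg y the
-- algebra is a Boolean algebra, and every term that is not a literal (a variable under
-- iterated *) takes only values with reg x ≡ x. Hence an identity between non-literals
-- holds in Q as soon as it holds in all Boolean algebras, i.e. (by Shannon expansion) as
-- soon as it holds in 𝟐, which sits inside 𝟒 as {0, 1}. If a literal is involved, 𝟒 alone
-- decides the identity: its elements a and b are the only ones with reg x ≢ x, and an
-- assignment sending one variable to a and the others to 0 tells all literals apart.
module Submission where

open import Defs
open import Level as L using (Level; 0ℓ)
open import Algebra.Bundles using (CommutativeSemigroup)
open import Algebra.Core using (Op₂)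
open import Algebra.Definitions using (Commutative; Associative)
import Algebra.Properties.CommutativeSemigroup as CommutativeSemigroupProperties
open import Algebra.Lattice.Bundles using (BooleanAlgebra)
open import Algebra.Lattice.Structures.Biased using (isBooleanAlgebraʳ; isDistributiveLatticeʳʲᵐ)
import Algebra.Lattice.Properties.BooleanAlgebra as BooleanAlgebraProperties
open import Data.Bool.Base using (Bool; true; false; not; if_then_else_)
import Data.Bool.Base as 𝔹
open import Data.Bool.Properties using (∨-∧-booleanAlgebra)
open import Data.Empty using (⊥-elim)
open import Data.Nat.Base using (ℕ; zero; suc; _≤_; _<_; _⊔_; z≤n)
open import Data.Nat.Properties using (_≟_; _<?_; ≤-refl; ≤∧≢⇒<; ≤⇒≯; m<n⇒m<n⊔o; m<n⇒m<o⊔n)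
open import Data.Product using (Σ; _×_; _,_; proj₁; proj₂)
open import Function.Base using (_∘_)
open import Relation.Nullary.Decidable using (Dec; yes; no; does; map′; dec-true; dec-false)
import Relation.Binary.PropositionalEquality as ≡
open ≡ using (_≡_; _≢_)

private
  variable
    c ℓ : Level

varBound : Term → ℕ
varBound (var i)  = suc i
varBound (p ∨ₜ q) = varBound p ⊔ varBound q
varBound (p ∧ₜ q) = varBound p ⊔ varBound q
varBound (p *ₜ)   = varBound p
varBound 0ₜ       = 0
varBound 1ₜ       = 0

data Literal : Term → Set where
  var : (i : ℕ) → Literal (var i)
  neg : {t : Term} → Literal t → Literal (t *ₜ)

literal? : (t : Term) → Dec (Literal t)
literal? (var i)  = yes (var i)
literal? (t *ₜ)   = map′ neg (λ { (neg l) → l }) (literal? t)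
literal? (_ ∨ₜ _) = no λ ()
literal? (_ ∧ₜ _) = no λ ()
literal? 0ₜ       = no λ ()
literal? 1ₜ       = no λ ()

index : {t : Term} → Literal t → ℕ
index (var i) = i
index (neg l) = index l

polarity : {t : Term} → Literal t → Bool
polarity (var i) = false
polarity (neg l) = not (polarity l)

_[_]≔_ : {A : Set c} → (ℕ → A) → ℕ → A → ℕ → A
(ρ [ n ]≔ x) j = if does (j ≟ n) then x else ρ j

⟦_⟧ᴮ : Term → (B : BooleanAlgebra c ℓ) → (ℕ → BooleanAlgebra.Carrier B) → BooleanAlgebra.Carrier B
⟦ var i ⟧ᴮ  B ρ = ρ i
⟦ p ∨ₜ q ⟧ᴮ B ρ = BooleanAlgebra._∨_ B (⟦ p ⟧ᴮ B ρ) (⟦ q ⟧ᴮ B ρ)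
⟦ p ∧ₜ q ⟧ᴮ B ρ = BooleanAlgebra._∧_ B (⟦ p ⟧ᴮ B ρ) (⟦ q ⟧ᴮ B ρ)
⟦ p *ₜ ⟧ᴮ   B ρ = BooleanAlgebra.¬_ B (⟦ p ⟧ᴮ B ρ)
⟦ 0ₜ ⟧ᴮ     B ρ = BooleanAlgebra.⊥ B
⟦ 1ₜ ⟧ᴮ     B ρ = BooleanAlgebra.⊤ B

_⊨ᴮ_≈_ : BooleanAlgebra c ℓ → Term → Term → Set (c L.⊔ ℓ)
B ⊨ᴮ p ≈ q = ∀ ρ → BooleanAlgebra._≈_ B (⟦ p ⟧ᴮ B ρ) (⟦ q ⟧ᴮ B ρ)

𝟐 : BooleanAlgebra 0ℓ 0ℓ
𝟐 = ∨-∧-booleanAlgebra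

module BooleanCompleteness (B : BooleanAlgebra c ℓ) where
  open BooleanAlgebra B
  open BooleanAlgebraProperties B
  open import Relation.Binary.Reasoning.Setoid setoid

  fromBool : Bool → Carrier
  fromBool false = ⊥
  fromBool true  = ⊤

  fromBool-∨ : ∀ a b → fromBool a ∨ fromBool b ≈ fromBool (a 𝔹.∨ b)
  fromBool-∨ false b = ∨-identityˡ (fromBool b)
  fromBool-∨ true  b = ∨-zeroˡ (fromBool b)

  fromBool-∧ : ∀ a b → fromBool a ∧ fromBool b ≈ fromBool (a 𝔹.∧ b)
  fromBool-∧ false b = ∧-zeroˡ (fromBool b)
  fromBool-∧ true  b = ∧-identityˡ (fromBool b)

  fromBool-¬ : ∀ a → ¬ fromBool a ≈ fromBool (not a)
  fromBool-¬ false = ¬⊥≈⊤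
  fromBool-¬ true  = ¬⊤≈⊥

  ⟦⟧ᴮ-fromBool : ∀ t e → ⟦ t ⟧ᴮ B (fromBool ∘ e) ≈ fromBool (⟦ t ⟧ᴮ 𝟐 e)
  ⟦⟧ᴮ-fromBool (var i)  e = refl
  ⟦⟧ᴮ-fromBool (p ∨ₜ q) e = trans (∨-cong (⟦⟧ᴮ-fromBool p e) (⟦⟧ᴮ-fromBool q e)) (fromBool-∨ (⟦ p ⟧ᴮ 𝟐 e) (⟦ q ⟧ᴮ 𝟐 e))
  ⟦⟧ᴮ-fromBool (p ∧ₜ q) e = trans (∧-cong (⟦⟧ᴮ-fromBool p e) (⟦⟧ᴮ-fromBool q e)) (fromBool-∧ (⟦ p ⟧ᴮ 𝟐 e) (⟦ q ⟧ᴮ 𝟐 e))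
  ⟦⟧ᴮ-fromBool (p *ₜ)   e = trans (¬-cong (⟦⟧ᴮ-fromBool p e)) (fromBool-¬ (⟦ p ⟧ᴮ 𝟐 e))
  ⟦⟧ᴮ-fromBool 0ₜ       e = refl
  ⟦⟧ᴮ-fromBool 1ₜ       e = refl

  ⟦⟧ᴮ-cong : ∀ t {ρ σ} → (∀ {j} → j < varBound t → ρ j ≈ σ j) → ⟦ t ⟧ᴮ B ρ ≈ ⟦ t ⟧ᴮ B σ
  ⟦⟧ᴮ-cong (var i)  ρ≈σ = ρ≈σ ≤-refl
  ⟦⟧ᴮ-cong (p ∨ₜ q) ρ≈σ = ∨-cong (⟦⟧ᴮ-cong p (λ j< → ρ≈σ (m<n⇒m<n⊔o _ j<)))
                                  (⟦⟧ᴮ-cong q (λ j< → ρ≈σ (m<n⇒m<o⊔n _ j<)))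
  ⟦⟧ᴮ-cong (p ∧ₜ q) ρ≈σ = ∧-cong (⟦⟧ᴮ-cong p (λ j< → ρ≈σ (m<n⇒m<n⊔o _ j<)))
                                  (⟦⟧ᴮ-cong q (λ j< → ρ≈σ (m<n⇒m<o⊔n _ j<)))
  ⟦⟧ᴮ-cong (p *ₜ)   ρ≈σ = ¬-cong (⟦⟧ᴮ-cong p ρ≈σ)
  ⟦⟧ᴮ-cong 0ₜ       ρ≈σ = refl
  ⟦⟧ᴮ-cong 1ₜ       ρ≈σ = refl

  -- Equality below a: the congruence of B whose quotient is the interval [⊥, a].
  infix 4 _≈[_]_
  _≈[_]_ : Carrier → Carrier → Carrier → Set ℓ
  x ≈[ a ] y = a ∧ x ≈ a ∧ y

  ≈[]-∨ : ∀ {a x x′ y y′} → x ≈[ a ] x′ → y ≈[ a ] y′ → x ∨ y ≈[ a ] x′ ∨ y′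
  ≈[]-∨ {a} {x} {x′} {y} {y′} x≈x′ y≈y′ = begin
    a ∧ (x ∨ y)         ≈⟨ ∧-distribˡ-∨ a x y ⟩
    a ∧ x ∨ a ∧ y       ≈⟨ ∨-cong x≈x′ y≈y′ ⟩
    a ∧ x′ ∨ a ∧ y′     ≈⟨ ∧-distribˡ-∨ a x′ y′ ⟨
    a ∧ (x′ ∨ y′)       ∎

  ∧-distribˡ-∧ : ∀ a x y → a ∧ (x ∧ y) ≈ (a ∧ x) ∧ (a ∧ y)
  ∧-distribˡ-∧ a x y = begin
    a ∧ (x ∧ y)         ≈⟨ ∧-congʳ (∧-idem a) ⟨
    (a ∧ a) ∧ (x ∧ y)   ≈⟨ ∧-assoc a a (x ∧ y) ⟩
    a ∧ (a ∧ (x ∧ y))   ≈⟨ ∧-congˡ (∧-assoc a x y) ⟨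
    a ∧ ((a ∧ x) ∧ y)   ≈⟨ ∧-congˡ (∧-congʳ (∧-comm a x)) ⟩
    a ∧ ((x ∧ a) ∧ y)   ≈⟨ ∧-congˡ (∧-assoc x a y) ⟩
    a ∧ (x ∧ (a ∧ y))   ≈⟨ ∧-assoc a x (a ∧ y) ⟨
    (a ∧ x) ∧ (a ∧ y)   ∎

  ≈[]-∧ : ∀ {a x x′ y y′} → x ≈[ a ] x′ → y ≈[ a ] y′ → x ∧ y ≈[ a ] x′ ∧ y′
  ≈[]-∧ {a} {x} {x′} {y} {y′} x≈x′ y≈y′ = begin
    a ∧ (x ∧ y)         ≈⟨ ∧-distribˡ-∧ a x y ⟩
    (a ∧ x) ∧ (a ∧ y)   ≈⟨ ∧-cong x≈x′ y≈y′ ⟩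
    (a ∧ x′) ∧ (a ∧ y′) ≈⟨ ∧-distribˡ-∧ a x′ y′ ⟨
    a ∧ (x′ ∧ y′)       ∎

  ∧-¬-∧ : ∀ a x → a ∧ ¬ (a ∧ x) ≈ a ∧ ¬ x
  ∧-¬-∧ a x = begin
    a ∧ ¬ (a ∧ x)       ≈⟨ ∧-congˡ (deMorgan₁ a x) ⟩
    a ∧ (¬ a ∨ ¬ x)     ≈⟨ ∧-distribˡ-∨ a (¬ a) (¬ x) ⟩
    a ∧ ¬ a ∨ a ∧ ¬ x   ≈⟨ ∨-congʳ (∧-complementʳ a) ⟩
    ⊥ ∨ a ∧ ¬ x         ≈⟨ ∨-identityˡ (a ∧ ¬ x) ⟩
    a ∧ ¬ x             ∎

  ≈[]-¬ : ∀ {a x y} → x ≈[ a ] y → ¬ x ≈[ a ] ¬ y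
  ≈[]-¬ {a} {x} {y} x≈y = begin
    a ∧ ¬ x             ≈⟨ ∧-¬-∧ a x ⟨
    a ∧ ¬ (a ∧ x)       ≈⟨ ∧-congˡ (¬-cong x≈y) ⟩
    a ∧ ¬ (a ∧ y)       ≈⟨ ∧-¬-∧ a y ⟩
    a ∧ ¬ y             ∎

  ⟦⟧ᴮ-≈[] : ∀ t {a ρ σ} → (∀ j → ρ j ≈[ a ] σ j) → ⟦ t ⟧ᴮ B ρ ≈[ a ] ⟦ t ⟧ᴮ B σ
  ⟦⟧ᴮ-≈[] (var i)  ρ≈σ = ρ≈σ i
  ⟦⟧ᴮ-≈[] (p ∨ₜ q) ρ≈σ = ≈[]-∨ (⟦⟧ᴮ-≈[] p ρ≈σ) (⟦⟧ᴮ-≈[] q ρ≈σ)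
  ⟦⟧ᴮ-≈[] (p ∧ₜ q) ρ≈σ = ≈[]-∧ (⟦⟧ᴮ-≈[] p ρ≈σ) (⟦⟧ᴮ-≈[] q ρ≈σ)
  ⟦⟧ᴮ-≈[] (p *ₜ)   ρ≈σ = ≈[]-¬ (⟦⟧ᴮ-≈[] p ρ≈σ)
  ⟦⟧ᴮ-≈[] 0ₜ       ρ≈σ = refl
  ⟦⟧ᴮ-≈[] 1ₜ       ρ≈σ = refl

  ≈[]-update : ∀ {a ρ n x} → ρ n ≈[ a ] x → ∀ j → ρ j ≈[ a ] (ρ [ n ]≔ x) j
  ≈[]-update {n = n} ρn≈x j with j ≟ n
  ... | yes ≡.refl rewrite dec-true (n ≟ n) ≡.refl = ρn≈x
  ... | no j≢n     rewrite dec-false (j ≟ n) j≢n   = refl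

  shannon : ∀ a x → x ≈ a ∧ x ∨ ¬ a ∧ x
  shannon a x = begin
    x                   ≈⟨ ∧-identityˡ x ⟨
    ⊤ ∧ x               ≈⟨ ∧-congʳ (∨-complementʳ a) ⟨
    (a ∨ ¬ a) ∧ x       ≈⟨ ∧-distribʳ-∨ x a (¬ a) ⟩
    a ∧ x ∨ ¬ a ∧ x     ∎

  IsBoolean : Carrier → Set ℓ
  IsBoolean x = Σ Bool λ b → x ≈ fromBool b

  BooleanFrom : ℕ → (ℕ → Carrier) → Set ℓ
  BooleanFrom n ρ = ∀ {j} → n ≤ j → IsBoolean (ρ j)

  BooleanFrom-update : ∀ {n ρ x} → BooleanFrom (suc n) ρ → IsBoolean x → BooleanFrom n (ρ [ n ]≔ x)
  BooleanFrom-update {n} ρ-bool x-bool {j} n≤j with j ≟ n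
  ... | yes j≡n rewrite dec-true (j ≟ n) j≡n  = x-bool
  ... | no j≢n  rewrite dec-false (j ≟ n) j≢n = ρ-bool (≤∧≢⇒< n≤j (j≢n ∘ ≡.sym))

  module _ (p q : Term) (p≈q : 𝟐 ⊨ᴮ p ≈ q) where

    ⟦⟧ᴮ-agree-BooleanFrom : ∀ n ρ → BooleanFrom n ρ → ⟦ p ⟧ᴮ B ρ ≈ ⟦ q ⟧ᴮ B ρ
    ⟦⟧ᴮ-agree-BooleanFrom zero ρ ρ-bool = begin
      ⟦ p ⟧ᴮ B ρ              ≈⟨ ⟦⟧ᴮ-cong p (λ {j} _ → ρ≈e j) ⟩
      ⟦ p ⟧ᴮ B (fromBool ∘ e) ≈⟨ ⟦⟧ᴮ-fromBool p e ⟩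
      fromBool (⟦ p ⟧ᴮ 𝟐 e)   ≡⟨ ≡.cong fromBool (p≈q e) ⟩
      fromBool (⟦ q ⟧ᴮ 𝟐 e)   ≈⟨ ⟦⟧ᴮ-fromBool q e ⟨
      ⟦ q ⟧ᴮ B (fromBool ∘ e) ≈⟨ ⟦⟧ᴮ-cong q (λ {j} _ → ρ≈e j) ⟨
      ⟦ q ⟧ᴮ B ρ              ∎
      where
        e : ℕ → Bool
        e j = proj₁ (ρ-bool {j} z≤n)
        ρ≈e : ∀ j → ρ j ≈ fromBool (e j)
        ρ≈e j = proj₂ (ρ-bool {j} z≤n)
    -- Shannon expansion at the variable n: below ρ n it may be set to ⊤, below ¬ ρ n to ⊥.
    ⟦⟧ᴮ-agree-BooleanFrom (suc n) ρ ρ-bool = begin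
      ⟦ p ⟧ᴮ B ρ                              ≈⟨ shannon a _ ⟩
      a ∧ ⟦ p ⟧ᴮ B ρ ∨ ¬ a ∧ ⟦ p ⟧ᴮ B ρ       ≈⟨ ∨-cong (⟦⟧ᴮ-≈[] p ρ≈ρ⊤) (⟦⟧ᴮ-≈[] p ρ≈ρ⊥) ⟩
      a ∧ ⟦ p ⟧ᴮ B ρ⊤ ∨ ¬ a ∧ ⟦ p ⟧ᴮ B ρ⊥     ≈⟨ ∨-cong (∧-congˡ (agree true)) (∧-congˡ (agree false)) ⟩
      a ∧ ⟦ q ⟧ᴮ B ρ⊤ ∨ ¬ a ∧ ⟦ q ⟧ᴮ B ρ⊥     ≈⟨ ∨-cong (⟦⟧ᴮ-≈[] q ρ≈ρ⊤) (⟦⟧ᴮ-≈[] q ρ≈ρ⊥) ⟨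
      a ∧ ⟦ q ⟧ᴮ B ρ ∨ ¬ a ∧ ⟦ q ⟧ᴮ B ρ       ≈⟨ shannon a _ ⟨
      ⟦ q ⟧ᴮ B ρ                              ∎
      where
        a = ρ n
        ρ⊤ = ρ [ n ]≔ ⊤
        ρ⊥ = ρ [ n ]≔ ⊥
        ρ≈ρ⊤ : ∀ j → ρ j ≈[ a ] ρ⊤ j
        ρ≈ρ⊤ = ≈[]-update (trans (∧-idem a) (sym (∧-identityʳ a)))
        ρ≈ρ⊥ : ∀ j → ρ j ≈[ ¬ a ] ρ⊥ j
        ρ≈ρ⊥ = ≈[]-update (trans (∧-complementˡ a) (sym (∧-zeroʳ (¬ a))))
        agree : ∀ b → ⟦ p ⟧ᴮ B (ρ [ n ]≔ fromBool b) ≈ ⟦ q ⟧ᴮ B (ρ [ n ]≔ fromBool b)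
        agree b = ⟦⟧ᴮ-agree-BooleanFrom n _ (BooleanFrom-update ρ-bool (b , refl))

  𝟐-complete : ∀ p q → 𝟐 ⊨ᴮ p ≈ q → B ⊨ᴮ p ≈ q
  𝟐-complete p q p≈q ρ = begin
    ⟦ p ⟧ᴮ B ρ  ≈⟨ ⟦⟧ᴮ-cong p (λ j< → sym (truncate-below (m<n⇒m<n⊔o _ j<))) ⟩
    ⟦ p ⟧ᴮ B ρ′ ≈⟨ ⟦⟧ᴮ-agree-BooleanFrom p q p≈q N ρ′ truncate-BooleanFrom ⟩
    ⟦ q ⟧ᴮ B ρ′ ≈⟨ ⟦⟧ᴮ-cong q (λ j< → truncate-below (m<n⇒m<o⊔n _ j<)) ⟩
    ⟦ q ⟧ᴮ B ρ  ∎
    where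
      N = varBound p ⊔ varBound q
      ρ′ : ℕ → Carrier
      ρ′ j = if does (j <? N) then ρ j else ⊥
      truncate-below : ∀ {j} → j < N → ρ′ j ≈ ρ j
      truncate-below {j} j<N rewrite dec-true (j <? N) j<N = refl
      truncate-BooleanFrom : BooleanFrom N ρ′
      truncate-BooleanFrom {j} N≤j rewrite dec-false (j <? N) (≤⇒≯ N≤j) = false , refl

open BooleanCompleteness using (𝟐-complete)

-- Opened only from here on, since a Boolean algebra exports its own refl, sym, trans and ¬_.
open ≡ using (refl; sym; trans; cong; cong₂; subst₂; module ≡-Reasoning)
open import Relation.Nullary.Negation using (¬_)

≡-commutativeSemigroup : {A : Set} {_∙_ : Op₂ A} → Commutative _≡_ _∙_ → Associative _≡_ _∙_ →
                         CommutativeSemigroup 0ℓ 0ℓ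
≡-commutativeSemigroup {A} {_∙_} comm assoc = record
  { Carrier = A
  ; _≈_ = _≡_
  ; _∙_ = _∙_
  ; isCommutativeSemigroup = record
    { isSemigroup = record
      { isMagma = record { isEquivalence = ≡.isEquivalence ; ∙-cong = cong₂ _∙_ }
      ; assoc = assoc
      }
    ; comm = comm
    }
  }

module QBAlgebraProperties (Q : QBAlgebra) where
  open QBAlgebra Q
  open IsDistributiveQuasiLattice isDQL
  open IsQuasiLattice isQuasiLattice
  open CommutativeSemigroupProperties (≡-commutativeSemigroup ∨-comm ∨-assoc)
    using () renaming (interchange to ∨-interchange)
  open CommutativeSemigroupProperties (≡-commutativeSemigroup ∧-comm ∧-assoc)
    using () renaming (interchange to ∧-interchange)

  reg : Carrier → Carrier
  reg x = x ∨ x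

  ∨-idemˡ : ∀ x y → (x ∨ x) ∨ y ≡ x ∨ y
  ∨-idemˡ x y = trans (∨-comm (x ∨ x) y) (trans (∨-idem y x) (∨-comm y x))

  ∧-idemˡ : ∀ x y → (x ∧ x) ∧ y ≡ x ∧ y
  ∧-idemˡ x y = trans (∧-comm (x ∧ x) y) (trans (∧-idem y x) (∧-comm y x))

  ∨-reg : ∀ x y → reg x ∨ reg y ≡ x ∨ y
  ∨-reg x y = trans (∨-idem (x ∨ x) y) (∨-idemˡ x y)

  ∧-reg : ∀ x y → reg x ∧ reg y ≡ x ∧ y
  ∧-reg x y = trans (cong₂ _∧_ (∨∧-same x) (∨∧-same y)) (trans (∧-idem (x ∧ x) y) (∧-idemˡ x y))

  reg-∨ : ∀ x y → reg (x ∨ y) ≡ x ∨ y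
  reg-∨ x y = trans (∨-interchange x y x y) (∨-reg x y)

  reg-∧ : ∀ x y → reg (x ∧ y) ≡ x ∧ y
  reg-∧ x y = begin
    reg (x ∧ y)       ≡⟨ ∨∧-same (x ∧ y) ⟩
    (x ∧ y) ∧ (x ∧ y) ≡⟨ ∧-interchange x y x y ⟩
    (x ∧ x) ∧ (y ∧ y) ≡⟨ cong₂ _∧_ (∨∧-same x) (∨∧-same y) ⟨
    reg x ∧ reg y     ≡⟨ ∧-reg x y ⟩
    x ∧ y             ∎
    where open ≡-Reasoning

  reg-reg : ∀ x → reg (reg x) ≡ reg x
  reg-reg x = reg-∨ x x

  reg-* : ∀ x → reg (x *) ≡ reg x *
  reg-* x = trans (sym (*-∧∧ x)) (cong _* (sym (∨∧-same x)))

  reg-𝟎 : reg 𝟎 ≡ 𝟎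
  reg-𝟎 = trans (∨∧-same 𝟎) (∧-zero 𝟎)

  reg-𝟏 : reg 𝟏 ≡ 𝟏
  reg-𝟏 = ∨-one 𝟏

  infix 4 _≃_
  _≃_ : Carrier → Carrier → Set
  x ≃ y = reg x ≡ reg y

  ∨-cong-≃ : ∀ {x x′ y y′} → x ≃ x′ → y ≃ y′ → x ∨ y ≡ x′ ∨ y′
  ∨-cong-≃ {x} {x′} {y} {y′} x≃x′ y≃y′ = trans (sym (∨-reg x y)) (trans (cong₂ _∨_ x≃x′ y≃y′) (∨-reg x′ y′))

  ∧-cong-≃ : ∀ {x x′ y y′} → x ≃ x′ → y ≃ y′ → x ∧ y ≡ x′ ∧ y′
  ∧-cong-≃ {x} {x′} {y} {y′} x≃x′ y≃y′ = trans (sym (∧-reg x y)) (trans (cong₂ _∧_ x≃x′ y≃y′) (∧-reg x′ y′))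

  regularBooleanAlgebra : BooleanAlgebra 0ℓ 0ℓ
  regularBooleanAlgebra = record
    { Carrier = Carrier ; _≈_ = _≃_ ; _∨_ = _∨_ ; _∧_ = _∧_ ; ¬_ = _* ; ⊤ = 𝟏 ; ⊥ = 𝟎
    ; isBooleanAlgebra = isBooleanAlgebraʳ record
      { isDistributiveLattice = isDistributiveLatticeʳʲᵐ record
        { isLattice = record
          { isEquivalence = record { refl = refl ; sym = sym ; trans = trans }
          ; ∨-comm = λ x y → cong reg (∨-comm x y)
          ; ∨-assoc = λ x y z → cong reg (∨-assoc x y z)
          ; ∨-cong = λ x≃x′ y≃y′ → cong reg (∨-cong-≃ x≃x′ y≃y′)
          ; ∧-comm = λ x y → cong reg (∧-comm x y)
          ; ∧-assoc = λ x y z → cong reg (∧-assoc x y z)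
          ; ∧-cong = λ x≃x′ y≃y′ → cong reg (∧-cong-≃ x≃x′ y≃y′)
          ; absorptive = (λ x y → trans (cong reg (∨-absorb x y)) (reg-reg x))
                       , (λ x y → trans (cong reg (trans (∧-absorb x y) (sym (∨∧-same x)))) (reg-reg x))
          }
        ; ∨-distribʳ-∧ = λ x y z → cong reg (trans (∨-comm (y ∧ z) x)
                           (trans (∨-distrib-∧ x y z) (cong₂ _∧_ (∨-comm x y) (∨-comm x z))))
        }
      ; ∨-complementʳ = λ x → cong reg (∨-compl x)
      ; ∧-complementʳ = λ x → cong reg (∧-compl x)
      ; ¬-cong = λ {x} {y} x≃y → trans (reg-* x) (trans (cong _* x≃y) (sym (reg-* y)))
      }
    }

  ⟦⟧≡⟦⟧ᴮ : ∀ t ρ → ⟦ t ⟧ Q ρ ≡ ⟦ t ⟧ᴮ regularBooleanAlgebra ρ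
  ⟦⟧≡⟦⟧ᴮ (var i)  ρ = refl
  ⟦⟧≡⟦⟧ᴮ (p ∨ₜ q) ρ = cong₂ _∨_ (⟦⟧≡⟦⟧ᴮ p ρ) (⟦⟧≡⟦⟧ᴮ q ρ)
  ⟦⟧≡⟦⟧ᴮ (p ∧ₜ q) ρ = cong₂ _∧_ (⟦⟧≡⟦⟧ᴮ p ρ) (⟦⟧≡⟦⟧ᴮ q ρ)
  ⟦⟧≡⟦⟧ᴮ (p *ₜ)   ρ = cong _* (⟦⟧≡⟦⟧ᴮ p ρ)
  ⟦⟧≡⟦⟧ᴮ 0ₜ       ρ = refl
  ⟦⟧≡⟦⟧ᴮ 1ₜ       ρ = refl

  reg-nonliteral : ∀ {t} → ¬ Literal t → ∀ ρ → reg (⟦ t ⟧ Q ρ) ≡ ⟦ t ⟧ Q ρ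
  reg-nonliteral {var i}  ¬l ρ = ⊥-elim (¬l (var i))
  reg-nonliteral {p ∨ₜ q} ¬l ρ = reg-∨ (⟦ p ⟧ Q ρ) (⟦ q ⟧ Q ρ)
  reg-nonliteral {p ∧ₜ q} ¬l ρ = reg-∧ (⟦ p ⟧ Q ρ) (⟦ q ⟧ Q ρ)
  reg-nonliteral {p *ₜ}   ¬l ρ = trans (reg-* (⟦ p ⟧ Q ρ)) (cong _* (reg-nonliteral (¬l ∘ neg) ρ))
  reg-nonliteral {0ₜ}     ¬l ρ = reg-𝟎
  reg-nonliteral {1ₜ}     ¬l ρ = reg-𝟏

  ⊨-nonliterals : ∀ {p q} → ¬ Literal p → ¬ Literal q → regularBooleanAlgebra ⊨ᴮ p ≈ q → Q ⊨ p ≈ q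
  ⊨-nonliterals {p} {q} ¬lp ¬lq p≃q ρ = begin
    ⟦ p ⟧ Q ρ                             ≡⟨ reg-nonliteral ¬lp ρ ⟨
    reg (⟦ p ⟧ Q ρ)                       ≡⟨ cong reg (⟦⟧≡⟦⟧ᴮ p ρ) ⟩
    reg (⟦ p ⟧ᴮ regularBooleanAlgebra ρ)  ≡⟨ p≃q ρ ⟩
    reg (⟦ q ⟧ᴮ regularBooleanAlgebra ρ)  ≡⟨ cong reg (⟦⟧≡⟦⟧ᴮ q ρ) ⟨
    reg (⟦ q ⟧ Q ρ)                       ≡⟨ reg-nonliteral ¬lq ρ ⟩
    ⟦ q ⟧ Q ρ                             ∎
    where open ≡-Reasoning

  signed : Carrier → Bool → Carrier
  signed x false = x
  signed x true  = x *

  signed-* : ∀ x b → signed x b * ≡ signed x (not b)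
  signed-* x false = refl
  signed-* x true  = *-invol x

  ⟦literal⟧ : ∀ {t} (l : Literal t) ρ → ⟦ t ⟧ Q ρ ≡ signed (ρ (index l)) (polarity l)
  ⟦literal⟧ (var i) ρ = refl
  ⟦literal⟧ (neg l) ρ = trans (cong _* (⟦literal⟧ l ρ)) (signed-* (ρ (index l)) (polarity l))

  ⊨-literals : ∀ {p q} (lp : Literal p) (lq : Literal q) →
               index lp ≡ index lq × polarity lp ≡ polarity lq → Q ⊨ p ≈ q
  ⊨-literals lp lq (i≡j , b≡c) ρ =
    trans (⟦literal⟧ lp ρ) (trans (cong₂ (signed ∘ ρ) i≡j b≡c) (sym (⟦literal⟧ lq ρ)))

open QBAlgebraProperties

toFour : Bool → Four
toFour false = f0
toFour true  = f1

toFour-injective : ∀ {a b} → toFour a ≡ toFour b → a ≡ b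
toFour-injective {false} {false} _ = refl
toFour-injective {true}  {true}  _ = refl

toFour-∨ : ∀ a b → toFour a ∨₄ toFour b ≡ toFour (a 𝔹.∨ b)
toFour-∨ false false = refl
toFour-∨ false true  = refl
toFour-∨ true  false = refl
toFour-∨ true  true  = refl

toFour-∧ : ∀ a b → toFour a ∧₄ toFour b ≡ toFour (a 𝔹.∧ b)
toFour-∧ false false = refl
toFour-∧ false true  = refl
toFour-∧ true  false = refl
toFour-∧ true  true  = refl

toFour-* : ∀ a → toFour a *₄ ≡ toFour (not a)
toFour-* false = refl
toFour-* true  = refl

⟦⟧-toFour : ∀ t e → ⟦ t ⟧ 𝟒 (toFour ∘ e) ≡ toFour (⟦ t ⟧ᴮ 𝟐 e)
⟦⟧-toFour (var i)  e = refl
⟦⟧-toFour (p ∨ₜ q) e = trans (cong₂ _∨₄_ (⟦⟧-toFour p e) (⟦⟧-toFour q e)) (toFour-∨ (⟦ p ⟧ᴮ 𝟐 e) (⟦ q ⟧ᴮ 𝟐 e))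
⟦⟧-toFour (p ∧ₜ q) e = trans (cong₂ _∧₄_ (⟦⟧-toFour p e) (⟦⟧-toFour q e)) (toFour-∧ (⟦ p ⟧ᴮ 𝟐 e) (⟦ q ⟧ᴮ 𝟐 e))
⟦⟧-toFour (p *ₜ)   e = trans (cong _*₄ (⟦⟧-toFour p e)) (toFour-* (⟦ p ⟧ᴮ 𝟐 e))
⟦⟧-toFour 0ₜ       e = refl
⟦⟧-toFour 1ₜ       e = refl

𝟒⊨⇒𝟐⊨ : ∀ p q → 𝟒 ⊨ p ≈ q → 𝟐 ⊨ᴮ p ≈ q
𝟒⊨⇒𝟐⊨ p q p≈q e =
  toFour-injective (trans (sym (⟦⟧-toFour p e)) (trans (p≈q (toFour ∘ e)) (⟦⟧-toFour q e)))

signed-fa-irregular : ∀ b → reg 𝟒 (signed 𝟒 fa b) ≢ signed 𝟒 fa b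
signed-fa-irregular false ()
signed-fa-irregular true  ()

signed-fa-injective : ∀ b c → signed 𝟒 fa b ≡ signed 𝟒 fa c → b ≡ c
signed-fa-injective false false _ = refl
signed-fa-injective true  true  _ = refl

signed-fa≢signed-f0 : ∀ b c → signed 𝟒 fa b ≢ signed 𝟒 f0 c
signed-fa≢signed-f0 false false ()
signed-fa≢signed-f0 false true  ()
signed-fa≢signed-f0 true  false ()
signed-fa≢signed-f0 true  true  ()

𝟒-literal≉nonliteral : ∀ {p q} → Literal p → ¬ Literal q → ¬ 𝟒 ⊨ p ≈ q
𝟒-literal≉nonliteral {p} {q} lp ¬lq p≈q = signed-fa-irregular (polarity lp) (begin
  reg 𝟒 (signed 𝟒 fa (polarity lp)) ≡⟨ cong (reg 𝟒) p≡q ⟩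
  reg 𝟒 (⟦ q ⟧ 𝟒 ρ)                 ≡⟨ reg-nonliteral 𝟒 ¬lq ρ ⟩
  ⟦ q ⟧ 𝟒 ρ                         ≡⟨ p≡q ⟨
  signed 𝟒 fa (polarity lp)         ∎)
  where
    open ≡-Reasoning
    ρ : ℕ → Four
    ρ _ = fa
    p≡q : signed 𝟒 fa (polarity lp) ≡ ⟦ q ⟧ 𝟒 ρ
    p≡q = trans (sym (⟦literal⟧ 𝟒 lp ρ)) (p≈q ρ)

pointAt : ℕ → ℕ → Four
pointAt i k = if does (k ≟ i) then fa else f0

pointAt-same : ∀ i → pointAt i i ≡ fa
pointAt-same i rewrite dec-true (i ≟ i) refl = refl

pointAt-other : ∀ {i j} → j ≢ i → pointAt i j ≡ f0
pointAt-other {i} {j} j≢i rewrite dec-false (j ≟ i) j≢i = refl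

𝟒-separates-signed : ∀ i j b c → (∀ ρ → signed 𝟒 (ρ i) b ≡ signed 𝟒 (ρ j) c) → i ≡ j × b ≡ c
𝟒-separates-signed i j b c values = separate (j ≟ i)
  where
    atPoint : ∀ {x y} → pointAt i i ≡ x → pointAt i j ≡ y → signed 𝟒 x b ≡ signed 𝟒 y c
    atPoint ≡x ≡y = subst₂ (λ x y → signed 𝟒 x b ≡ signed 𝟒 y c) ≡x ≡y (values (pointAt i))
    separate : Dec (j ≡ i) → i ≡ j × b ≡ c
    separate (yes refl) = refl , signed-fa-injective b c (atPoint (pointAt-same i) (pointAt-same i))
    separate (no j≢i)   = ⊥-elim (signed-fa≢signed-f0 b c (atPoint (pointAt-same i) (pointAt-other j≢i)))

𝟒-separates-literals : ∀ {p q} (lp : Literal p) (lq : Literal q) → 𝟒 ⊨ p ≈ q →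
                       index lp ≡ index lq × polarity lp ≡ polarity lq
𝟒-separates-literals lp lq p≈q = 𝟒-separates-signed _ _ _ _ λ ρ →
  trans (sym (⟦literal⟧ 𝟒 lp ρ)) (trans (p≈q ρ) (⟦literal⟧ 𝟒 lq ρ))

theorem4p3 : (p q : Term) → ((∀ (Q : QBAlgebra) → Q ⊨ p ≈ q) → 𝟒 ⊨ p ≈ q) × (𝟒 ⊨ p ≈ q → ∀ (Q : QBAlgebra) → Q ⊨ p ≈ q)
theorem4p3 p q = (λ valid → valid 𝟒) , 𝟒-complete
  where
    𝟒-complete : 𝟒 ⊨ p ≈ q → ∀ Q → Q ⊨ p ≈ q
    𝟒-complete p≈q Q with literal? p | literal? q
    ... | yes lp  | yes lq  = ⊨-literals Q lp lq (𝟒-separates-literals lp lq p≈q)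
    ... | yes lp  | no ¬lq  = ⊥-elim (𝟒-literal≉nonliteral lp ¬lq p≈q)
    ... | no ¬lp  | yes lq  = ⊥-elim (𝟒-literal≉nonliteral lq ¬lp (λ ρ → sym (p≈q ρ)))
    ... | no ¬lp  | no ¬lq  =
      ⊨-nonliterals Q ¬lp ¬lq (𝟐-complete (regularBooleanAlgebra Q) p q (𝟒⊨⇒𝟐⊨ p q p≈q))
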